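{- Let $n\geq 4$ be an even integer, let $\mathbb{D}_{2n}=\langle a,b \mid a^n=b^2=1,\ ba=a^{n-1}b\rangle$ be the dihedral group of order $2n$, and let $\Psi=\{ab, a^{2}b, \dots , a^{n-1}b, b\}\cup\{a^{n/2}\}$. Then the Cayley graph $\Lambda=\mathrm{Cay}(\mathbb{D}_{2n}, \Psi)$ is not a distance regular graph.
   Context: For a finite group $G$ and an inverse-closed subset $Q\subseteq G\setminus\{1\}$, the Cayley graph $\mathrm{Cay}(G,Q)$ has vertex set $G$ and edge set $\{\{x,y\} : x^{ -1}y\in Q\}$. A connected regular graph $\Gamma$ of diameter $d$ is distance regular if for all $0\le r\le d$ there are constants $b_r,c_r$ such that for any vertices $u,v$ with $d(u,v)=r$, the number of neighbours of $u$ at distance $r+1$ from $v$ is $b_r$ and the number of neighbours of $u$ at distance $r-1$ from $v$ is $c_r$. -}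

module Defs where

open import Data.Nat using (ℕ; zero; suc; _<_; _∸_; _/_; NonZero)
import Data.Nat as N
open import Data.Nat.DivMod using (_mod_)
open import Data.Fin using (Fin; toℕ)
open import Data.Bool using (Bool; true; false; if_then_else_; _xor_)
open import Data.Product using (Σ; ∃; _×_; _,_)
open import Data.Sum using (_⊎_)
open import Data.List using (List; length)
open import Data.List.Membership.Propositional using (_∈_)
open import Data.List.Relation.Unary.Unique.Propositional using (Unique)
open import Relation.Binary.PropositionalEquality using (_≡_)
open import Relation.Nullary using (¬_)
open import Function.Bundles using (_⇔_)

module GraphTheory {V : Set} (Adj : V → V → Set) where

  data Walk : V → V → ℕ → Set where
    here : ∀ {u} → Walk u u 0
    step : ∀ {u w v k} → Adj u w → Walk w v k → Walk u v (suc k)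

  Dist : V → V → ℕ → Set
  Dist u v r = Walk u v r × (∀ k → k < r → ¬ Walk u v k)

  Connected : Set
  Connected = ∀ u v → ∃ λ r → Walk u v r

  HasCount : (V → Set) → ℕ → Set
  HasCount P b = Σ (List V) λ xs → Unique xs × (∀ x → (x ∈ xs) ⇔ P x) × length xs ≡ b

  Regular : Set
  Regular = ∃ λ k → ∀ u → HasCount (Adj u) k

  -- Distance regularity.  For r larger than the diameter the condition is
  -- vacuous (no pair is at distance r), so quantifying over all r is the
  -- same as quantifying over 0 ≤ r ≤ d.
  IsDistanceRegular : Set
  IsDistanceRegular =
    Connected × Regular ×
    (∀ r → Σ ℕ λ b → Σ ℕ λ c → ∀ u v → Dist u v r →
       HasCount (λ w → Adj u w × Dist w v (suc r)) b ×
       HasCount (λ w → Adj u w × (∃ λ r' → r ≡ suc r' × Dist w v r')) c)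

-- The dihedral group D_{2n} = ⟨a,b | aⁿ = b² = 1, ba = aⁿ⁻¹b⟩,
-- modelled concretely: (i , s) stands for a^i b^s (s = true means b¹).

module Dihedral (n : ℕ) .{{_ : NonZero n}} where

  D : Set
  D = Fin n × Bool

  negF : Fin n → Fin n
  negF k = (n ∸ toℕ k) mod n

  addF : Fin n → Fin n → Fin n
  addF i k = (toℕ i N.+ toℕ k) mod n

  -- (a^i b^s)(a^k b^t) = a^(i + (-1)^s k) b^(s+t)
  _·_ : D → D → D
  (i , s) · (k , t) = addF i (if s then negF k else k) , (s xor t)

  inv : D → D
  inv (i , false) = negF i , false
  inv (i , true)  = i , true

  Ψ : D → Set
  Ψ (i , s) = (s ≡ true) ⊎ (s ≡ false × toℕ i ≡ n / 2)

  CayAdj : D → D → Set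
  CayAdj x y = Ψ (inv x · y)

module Submission where

-- Write e = a⁰ for the identity and h = n/2.  In Cay(D_{2n}, Ψ)
-- every reflection is adjacent to every rotation, while the only rotation
-- adjacent to e is a^h.  We compare the intersection number b₁ at two pairs
-- of vertices at distance 1:
--   * (e, a^h): every neighbour of e (a reflection or a^h itself) is at
--     distance at most 1 from a^h, so b₁ would have to be 0;
--   * (e, b):   the neighbour ab of e is at distance 2 from b (ab ~ a^h ~ b,
--     and ab is not adjacent to b because 1 ≠ h), so b₁ would have to be ≥ 1.
-- The file first proves, for an arbitrary graph, elementary facts on walks
-- and distances, counting lemmas for HasCount, and the resulting criterion
-- "b_r takes a zero and a non-zero value ⇒ not distance regular".  It then
-- computes the needed adjacencies in the dihedral model, and the theorem is
-- the criterion applied to the two pairs above.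

open import Defs
open import Data.Nat using (ℕ; _≤_; NonZero)
open import Data.Nat.Divisibility using (_∣_)
open import Relation.Nullary using (¬_)

open import Data.Nat using (zero; suc; _<_; _+_; _∸_; _/_; _%_; s≤s; z≤n)
open import Data.Nat.Properties using (<-≤-trans; <-irrefl; +-identityʳ)
open import Data.Nat.DivMod using (n%n≡0; m<n⇒m%n≡m; m/n<m; /-monoˡ-≤; m%n<n)
open import Data.Fin using (Fin; toℕ; fromℕ<)
open import Data.Fin.Properties using (toℕ-fromℕ<; toℕ-injective; toℕ<n)
open import Data.Bool using (true; false)
open import Data.Product using (_,_; proj₁; proj₂)
open import Data.Sum using (inj₁; inj₂)
open import Data.List using ([]; _∷_)
open import Data.List.Relation.Unary.Any using (here)
open import Relation.Binary.PropositionalEquality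
  using (_≡_; _≢_; refl; sym; trans; cong; subst; module ≡-Reasoning)
open import Function.Bundles using (Equivalence)

module GraphFacts {V : Set} (Adj : V → V → Set) where
  open GraphTheory Adj

  walk-zero : ∀ {u v} → Walk u v 0 → u ≡ v
  walk-zero here = refl

  walk-one : ∀ {u v} → Walk u v 1 → Adj u v
  walk-one (step a here) = a

  dist-one : ∀ {u v} → Adj u v → u ≢ v → Dist u v 1
  dist-one a u≢v = step a here , λ
    { zero _ w → u≢v (walk-zero w)
    ; (suc _) (s≤s ()) _ }

  dist-two : ∀ {u w v} → Adj u w → Adj w v → u ≢ v → ¬ Adj u v → Dist u v 2
  dist-two a a' u≢v u≁v = step a (step a' here) , λ
    { zero _ w → u≢v (walk-zero w)
    ; (suc zero) _ w → u≁v (walk-one w)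
    ; (suc (suc _)) (s≤s (s≤s ())) _ }

  count-empty : ∀ {P : V → Set} {b} → (∀ x → ¬ P x) → HasCount P b → b ≡ 0
  count-empty none ([] , _ , _ , len) = sym len
  count-empty none (x ∷ _ , _ , iff , _) with () ← none x (Equivalence.to (iff x) (here refl))

  count-inhabited : ∀ {P : V → Set} {b} x → P x → HasCount P b → 0 < b
  count-inhabited x px ([] , _ , iff , _) with () ← Equivalence.from (iff x) px
  count-inhabited x px (_ ∷ _ , _ , _ , refl) = s≤s z≤n

  b-not-constant : ∀ r {u v u' v'} → Dist u v r → Dist u' v' r →
    (∀ w → Adj u w → ¬ Dist w v (suc r)) →
    (w : V) → Adj u' w → Dist w v' (suc r) → ¬ IsDistanceRegular
  b-not-constant r d d' none w a dw (_ , _ , intersection) with intersection r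
  ... | b , _ , counts =
    <-irrefl refl (subst (0 <_) b≡0 (count-inhabited w (a , dw) (proj₁ (counts _ _ d'))))
    where
      b≡0 : b ≡ 0
      b≡0 = count-empty (λ x p → none x (proj₁ p) (proj₂ p)) (proj₁ (counts _ _ d))

module DihedralFacts (n : ℕ) .{{_ : NonZero n}} (4≤n : 4 ≤ n) where
  open Dihedral n

  h : ℕ
  h = n / 2

  2≤h : 2 ≤ h
  2≤h = /-monoˡ-≤ 2 4≤n

  zeroF oneF halfF : Fin n
  zeroF = fromℕ< (<-≤-trans (s≤s z≤n) 4≤n)
  oneF  = fromℕ< (<-≤-trans (s≤s (s≤s z≤n)) 4≤n)
  halfF = fromℕ< (m/n<m n 2 (s≤s (s≤s z≤n)))

  toℕ-zeroF : toℕ zeroF ≡ 0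
  toℕ-zeroF = toℕ-fromℕ< _

  toℕ-oneF : toℕ oneF ≡ 1
  toℕ-oneF = toℕ-fromℕ< _

  toℕ-halfF : toℕ halfF ≡ h
  toℕ-halfF = toℕ-fromℕ< _

  toℕ-addF : ∀ i k → toℕ (addF i k) ≡ (toℕ i + toℕ k) % n
  toℕ-addF i k = toℕ-fromℕ< (m%n<n _ n)

  negF-zero : negF zeroF ≡ zeroF
  negF-zero = toℕ-injective (begin
    toℕ (negF zeroF)          ≡⟨ toℕ-fromℕ< (m%n<n _ n) ⟩
    (n ∸ toℕ zeroF) % n       ≡⟨ cong (λ t → (n ∸ t) % n) toℕ-zeroF ⟩
    n % n                     ≡⟨ n%n≡0 n ⟩
    0                         ≡⟨ sym toℕ-zeroF ⟩
    toℕ zeroF                 ∎)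
    where open ≡-Reasoning

  addF-identityˡ : ∀ i → addF zeroF i ≡ i
  addF-identityˡ i = toℕ-injective (begin
    toℕ (addF zeroF i)        ≡⟨ toℕ-addF zeroF i ⟩
    (toℕ zeroF + toℕ i) % n   ≡⟨ cong (λ t → (t + toℕ i) % n) toℕ-zeroF ⟩
    toℕ i % n                 ≡⟨ m<n⇒m%n≡m (toℕ<n i) ⟩
    toℕ i                     ∎)
    where open ≡-Reasoning

  addF-identityʳ : ∀ i → addF i zeroF ≡ i
  addF-identityʳ i = toℕ-injective (begin
    toℕ (addF i zeroF)        ≡⟨ toℕ-addF i zeroF ⟩
    (toℕ i + toℕ zeroF) % n   ≡⟨ cong (λ t → (toℕ i + t) % n) toℕ-zeroF ⟩
    (toℕ i + 0) % n           ≡⟨ cong (_% n) (+-identityʳ (toℕ i)) ⟩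
    toℕ i % n                 ≡⟨ m<n⇒m%n≡m (toℕ<n i) ⟩
    toℕ i                     ∎)
    where open ≡-Reasoning

  h≢0 : 0 ≢ h
  h≢0 0≡h with () ← subst (2 ≤_) (sym 0≡h) 2≤h

  h≢1 : 1 ≢ h
  h≢1 1≡h with s≤s () ← subst (2 ≤_) (sym 1≡h) 2≤h

  e ah b ab : D
  e  = zeroF , false
  ah = halfF , false
  b  = zeroF , true
  ab = oneF , true

  rotation~reflection : ∀ i j → CayAdj (i , false) (j , true)
  rotation~reflection i j = inj₁ refl

  reflection~rotation : ∀ i j → CayAdj (i , true) (j , false)
  reflection~rotation i j = inj₁ refl

  -- Since e⁻¹ = e, the rotations adjacent to e are those in Ψ, i.e. a^h only.
  e~rotation : ∀ i → CayAdj e (i , false) → i ≡ halfF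
  e~rotation i (inj₂ (_ , toℕ≡h)) = toℕ-injective (begin
    toℕ i                     ≡⟨ cong toℕ (sym (addF-identityˡ i)) ⟩
    toℕ (addF zeroF i)        ≡⟨ cong (λ z → toℕ (addF z i)) (sym negF-zero) ⟩
    toℕ (addF (negF zeroF) i) ≡⟨ toℕ≡h ⟩
    h                         ≡⟨ sym toℕ-halfF ⟩
    toℕ halfF                 ∎)
    where open ≡-Reasoning

  e~ah : CayAdj e ah
  e~ah = inj₂ (refl , (begin
    toℕ (addF (negF zeroF) halfF) ≡⟨ cong (λ z → toℕ (addF z halfF)) negF-zero ⟩
    toℕ (addF zeroF halfF)        ≡⟨ cong toℕ (addF-identityˡ halfF) ⟩
    toℕ halfF                     ≡⟨ toℕ-halfF ⟩
    h                             ∎))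
    where open ≡-Reasoning

  -- (ab)⁻¹b = a, which is not in Ψ because 1 ≠ h.
  ab≁b : ¬ CayAdj ab b
  ab≁b (inj₂ (_ , toℕ≡h)) = h≢1 (begin
    1                             ≡⟨ sym toℕ-oneF ⟩
    toℕ oneF                      ≡⟨ cong toℕ (sym (addF-identityʳ oneF)) ⟩
    toℕ (addF oneF zeroF)         ≡⟨ cong (λ z → toℕ (addF oneF z)) (sym negF-zero) ⟩
    toℕ (addF oneF (negF zeroF))  ≡⟨ toℕ≡h ⟩
    h                             ∎)
    where open ≡-Reasoning

  e≢ah : e ≢ ah
  e≢ah eq = h≢0 (begin
    0            ≡⟨ sym toℕ-zeroF ⟩
    toℕ zeroF    ≡⟨ cong (λ x → toℕ (proj₁ x)) eq ⟩
    toℕ halfF    ≡⟨ toℕ-halfF ⟩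
    h            ∎)
    where open ≡-Reasoning

  e≢b : e ≢ b
  e≢b ()

  ab≢b : ab ≢ b
  ab≢b eq with () ← trans (sym toℕ-oneF) (trans (cong (λ x → toℕ (proj₁ x)) eq) toℕ-zeroF)

  open GraphTheory CayAdj
  open GraphFacts CayAdj

  -- No neighbour of e is at distance 2 from a^h: reflections are adjacent
  -- to a^h, and the only rotation adjacent to e is a^h itself.
  e-neighbours-near-ah : ∀ w → CayAdj e w → ¬ Dist w ah 2
  e-neighbours-near-ah (i , true) _ (_ , shorter) =
    shorter 1 (s≤s (s≤s z≤n)) (step (reflection~rotation i halfF) here)
  e-neighbours-near-ah (i , false) e~w (_ , shorter)
    rewrite e~rotation i e~w = shorter 0 (s≤s z≤n) here

  ab-far-from-b : Dist ab b 2
  ab-far-from-b =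
    dist-two {w = ah} (reflection~rotation oneF halfF) (rotation~reflection halfF zeroF) ab≢b ab≁b

  e~b : CayAdj e b
  e~b = rotation~reflection zeroF zeroF

proposition3p1 : (n : ℕ) .{{_ : NonZero n}} → 4 ≤ n → 2 ∣ n →
    ¬ GraphTheory.IsDistanceRegular (Dihedral.CayAdj n)
proposition3p1 n 4≤n _ =
  b-not-constant 1 (dist-one e~ah e≢ah) (dist-one e~b e≢b)
    e-neighbours-near-ah ab (rotation~reflection zeroF oneF) ab-far-from-b
  where
    open DihedralFacts n 4≤n
    open GraphFacts (Dihedral.CayAdj n)
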